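{- Let $p\geq 1$ be an integer and let $G$ be a finite simple graph which is $((K_1\cup K_2)+K_p)$-free and satisfies $\omega(G)\geq p+2$. Let $A=\{v_1,\dots,v_\omega\}$ be a maximum clique of $G$ (with $\omega=\omega(G)$), and let $I_k$, $U_k$, $C_{i,j}$, $V_2$ be defined with respect to $A$ as in the context. Then: (i) for all distinct $k,\ell\in\{1,\dots,\omega\}$, every vertex of $I_k$ is adjacent to every vertex of $I_\ell$; consequently the subgraph induced by $V_1=\bigcup_{k=1}^{\omega}U_k$ is a complete multipartite graph with parts $U_1,\dots,U_\omega$; (ii) $C_{i,j}=\emptyset$ for every $j\geq p+2$ and $1\leq i<j$; (iii) every vertex $x\in V_2$ has neighbours in at most $p-1$ of the sets $U_\ell$, $\ell\in\{1,\dots,\omega\}$.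
   Context: All graphs are finite, simple, undirected. $\omega(G)$ is the clique number. For graphs $G_1,G_2$ on disjoint vertex sets, $G_1\cup G_2$ is their disjoint union and $G_1+G_2$ is their join (disjoint union plus all edges between them). $K_n$ is the complete graph on $n$ vertices, $2K_1$ two isolated vertices. A graph is $H$-free if it has no induced subgraph isomorphic to $H$. Partition: let $A=\{v_1,\dots,v_\omega\}$ be a maximum clique of $G$, $\omega=\omega(G)$. Let $L=\{(i,j):1\le i<j\le\omega\}$ ordered lexicographically ($(i_1,j_1)<_L(i_2,j_2)$ iff $i_1<i_2$, or $i_1=i_2$ and $j_1<j_2$). For $(i,j)\in L$, $C_{i,j}$ is the set of vertices $v\in V(G)\setminus A$ adjacent to neither $v_i$ nor $v_j$, minus all $C_{i',j'}$ with $(i',j')<_L(i,j)$. For $1\le k\le\omega$, $I_k$ is the set of vertices $v\in V(G)\setminus A$ adjacent to $v_i$ for every $i\neq k$ (such $v$ is non-adjacent to $v_k$). Let $U_k=\{v_k\}\cup I_k$, $V_1=\bigcup_k U_k$, $V_2=\bigcup_{(i,j)\in L}C_{i,j}$; then $V(G)=V_1\cup V_2$. -}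

module Defs where

open import Data.Nat using (ℕ; zero; suc; _+_; _∸_; _≤_)
open import Data.Fin using (Fin; toℕ; splitAt; _≟_) renaming (_<_ to _<ᶠ_)
open import Data.Bool using (Bool; true; false; not)
open import Data.Sum using (_⊎_; inj₁; inj₂)
open import Data.Product using (Σ; ∃; _×_; _,_)
open import Relation.Binary.PropositionalEquality using (_≡_; refl; sym; _≢_)
open import Relation.Nullary using (¬_; yes; no)
open import Function.Definitions using (Injective)

record Graph : Set where
  field
    n      : ℕ
    adj    : Fin n → Fin n → Bool
    adj-sym    : ∀ x y → adj x y ≡ adj y x
    adj-irrefl : ∀ x → adj x x ≡ false

open Graph public

Edge : (G : Graph) → Fin (n G) → Fin (n G) → Set
Edge G x y = adj G x y ≡ true

Kadj : ∀ {m} → Fin m → Fin m → Bool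
Kadj a b with a ≟ b
... | yes _ = false
... | no _  = true

Kadj-sym : ∀ {m} (a b : Fin m) → Kadj a b ≡ Kadj b a
Kadj-sym a b with a ≟ b | b ≟ a
... | yes _ | yes _ = refl
... | yes p | no q  = Data.Empty.⊥-elim (q (sym p)) where import Data.Empty
... | no p  | yes q = Data.Empty.⊥-elim (p (sym q)) where import Data.Empty
... | no _  | no _  = refl

Kadj-irrefl : ∀ {m} (a : Fin m) → Kadj a a ≡ false
Kadj-irrefl a with a ≟ a
... | yes _ = refl
... | no q  = Data.Empty.⊥-elim (q refl) where import Data.Empty

K : ℕ → Graph
K m = record { n = m ; adj = Kadj ; adj-sym = Kadj-sym ; adj-irrefl = Kadj-irrefl }

-- Vertex set Fin (n G₁ + n G₂): first the vertices of G₁, then those of G₂.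
-- Edges inside each part are inherited; edges between the parts are all
-- present iff the flag b is true.
combine : Bool → Graph → Graph → Graph
combine b G₁ G₂ = record { n = n G₁ + n G₂ ; adj = a ; adj-sym = s ; adj-irrefl = i }
  where
  cross : Fin (n G₁) ⊎ Fin (n G₂) → Fin (n G₁) ⊎ Fin (n G₂) → Bool
  cross (inj₁ x) (inj₁ y) = adj G₁ x y
  cross (inj₁ x) (inj₂ y) = b
  cross (inj₂ x) (inj₁ y) = b
  cross (inj₂ x) (inj₂ y) = adj G₂ x y
  a : Fin (n G₁ + n G₂) → Fin (n G₁ + n G₂) → Bool
  a x y = cross (splitAt (n G₁) x) (splitAt (n G₁) y)
  s : ∀ x y → a x y ≡ a y x
  s x y with splitAt (n G₁) x | splitAt (n G₁) y
  ... | inj₁ u | inj₁ v = adj-sym G₁ u v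
  ... | inj₁ u | inj₂ v = refl
  ... | inj₂ u | inj₁ v = refl
  ... | inj₂ u | inj₂ v = adj-sym G₂ u v
  i : ∀ x → a x x ≡ false
  i x with splitAt (n G₁) x
  ... | inj₁ u = adj-irrefl G₁ u
  ... | inj₂ u = adj-irrefl G₂ u

_∪ᴳ_ : Graph → Graph → Graph
G₁ ∪ᴳ G₂ = combine false G₁ G₂

_+ᴳ_ : Graph → Graph → Graph
G₁ +ᴳ G₂ = combine true G₁ G₂

InducedSub : (H G : Graph) → Set
InducedSub H G = Σ (Fin (n H) → Fin (n G)) λ f →
  Injective _≡_ _≡_ f × (∀ a b → adj G (f a) (f b) ≡ adj H a b)

_-free : Graph → Graph → Set
(H -free) G = ¬ InducedSub H G

IsClique : (G : Graph) {m : ℕ} → (Fin m → Fin (n G)) → Set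
IsClique G f = Injective _≡_ _≡_ f × (∀ a b → a ≢ b → Edge G (f a) (f b))

IsMaxClique : (G : Graph) (ω : ℕ) → (Fin ω → Fin (n G)) → Set
IsMaxClique G ω A = IsClique G A ×
  (∀ (m : ℕ) (f : Fin m → Fin (n G)) → IsClique G f → m ≤ ω)

-- The partition with respect to a clique A = (v₁,…,v_ω), indexed 0-based
-- by Fin ω (index k : Fin ω corresponds to v_{toℕ k + 1}).

module Partition (G : Graph) {ω : ℕ} (A : Fin ω → Fin (n G)) where

  Outside : Fin (n G) → Set
  Outside v = ∀ i → A i ≢ v

  I : Fin ω → Fin (n G) → Set
  I k v = Outside v × (∀ i → i ≢ k → Edge G v (A i))

  U : Fin ω → Fin (n G) → Set
  U k v = (v ≡ A k) ⊎ I k v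

  V₁ : Fin (n G) → Set
  V₁ v = ∃ λ k → U k v

  Miss : Fin ω → Fin ω → Fin (n G) → Set
  Miss i j v = Outside v × adj G v (A i) ≡ false × adj G v (A j) ≡ false

  _<L_ : (Fin ω × Fin ω) → (Fin ω × Fin ω) → Set
  (i′ , j′) <L (i , j) = (i′ <ᶠ i) ⊎ ((i′ ≡ i) × (j′ <ᶠ j))

  -- C_{i,j} (meaningful for i < j)
  C : Fin ω → Fin ω → Fin (n G) → Set
  C i j v = Miss i j v ×
    (∀ i′ j′ → i′ <ᶠ j′ → (i′ , j′) <L (i , j) → ¬ Miss i′ j′ v)

  V₂ : Fin (n G) → Set
  V₂ v = Σ (Fin ω) λ i → Σ (Fin ω) λ j → i <ᶠ j × C i j v

  HasNbrIn : Fin (n G) → Fin ω → Set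
  HasNbrIn x ℓ = ∃ λ y → U ℓ y × Edge G x y

  NbrPartsAtMost : Fin (n G) → ℕ → Set
  NbrPartsAtMost x r = ∀ (m : ℕ) (g : Fin m → Fin ω) → Injective _≡_ _≡_ g →
    (∀ t → HasNbrIn x (g t)) → m ≤ r

{-# OPTIONS --safe #-}
-- Every step exhibits an induced (K₁ ∪ K₂) + Kₚ: a vertex a, an edge b₁b₂ with
-- a adjacent to neither end, and a p-clique complete to a, b₁ and b₂. The p-clique
-- is taken from the maximum clique A (possible since ω ≥ p + 2), or from neighbours
-- of x in p distinct parts U_ℓ, which are pairwise adjacent by (i). Within one part,
-- two adjacent vertices of I_k would extend A ∖ {v_k} to a clique of size ω + 1.
-- For (ii), minimality of (i, j) makes a vertex of C_{i,j} adjacent to every v_t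
-- with t < j, t ≠ i. For (iii), if x misses v_i and v_j and sees p parts, then x
-- sees the clique vertex of each part it sees (else swapping one neighbour for a
-- clique vertex of an unseen part gives the forbidden graph), so v_i, v_j lie in
-- unseen parts, and x, v_i, v_j with the p neighbours form the forbidden graph.
module Submission where

open import Defs
open import Data.Nat using (ℕ; suc; _+_; _∸_; _≤_; _<_; z≤n; s≤s; _≤?_)
open import Data.Fin using (Fin; zero; suc; toℕ; splitAt; join; _≟_; punchIn; punchOut; inject≤)
  renaming (_<_ to _<ᶠ_)
open import Data.Fin.Properties
  using (join-splitAt; <-cmp; ¬∀⟶∃¬; any?; pigeonhole; <⇒≢; toℕ<n; toℕ-inject≤; inject≤-injective;
         punchIn-injective; punchInᵢ≢i; punchIn-punchOut)
open import Data.Nat.Properties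
  using (+-comm; +-suc; +-cancelʳ-≤; 1+n≰n; ≰⇒>; ≤-refl; ≤-trans; ≤-<-trans; <⇒≤; ≤-pred)
open import Data.Vec.Functional using ([]; _∷_; _++_; updateAt)
open import Data.Vec.Functional.Properties using (updateAt-updates; updateAt-minimal)
open import Data.Bool using (true; false)
open import Data.Sum using (inj₁; inj₂; [_,_])
open import Data.Product using (∃; ∃₂; _×_; _,_; proj₁; proj₂; map₂)
open import Data.Empty using (⊥; ⊥-elim)
open import Function using (_∘_; const)
open import Function.Definitions using (Injective)
open import Relation.Binary.PropositionalEquality
  using (_≡_; _≢_; refl; sym; trans; cong; subst; ≢-sym; module ≡-Reasoning)
open import Relation.Nullary using (¬_; yes; no)
open import Relation.Binary.Definitions using (tri<; tri≈; tri>)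

Misses : ∀ {m ω} → (Fin m → Fin ω) → Fin ω → Set
Misses f r = ∀ t → f t ≢ r

missed-value : ∀ {m ω} → m < ω → (f : Fin m → Fin ω) → ∃ (Misses f)
missed-value {ω = ω} m<ω f =
  map₂ (λ unhit t ft≡r → unhit (t , ft≡r)) (¬∀⟶∃¬ ω _ (λ r → any? λ t → f t ≟ r) not-onto)
  where
  not-onto : ¬ (∀ r → ∃ λ t → f t ≡ r)
  not-onto onto =
    let r , r′ , r<r′ , same = pigeonhole m<ω (proj₁ ∘ onto) in
    <⇒≢ r<r′ (trans (sym (proj₂ (onto r))) (trans (cong f same) (proj₂ (onto r′))))

two-missed-values : ∀ {m ω} → 2 + m ≤ ω → (f : Fin m → Fin ω) →
  ∃₂ λ r r′ → r ≢ r′ × Misses f r × Misses f r′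
two-missed-values 2+m≤ω f =
  let r , f-r = missed-value (<⇒≤ 2+m≤ω) f
      r′ , rf-r′ = missed-value 2+m≤ω (r ∷ f)
  in r , r′ , rf-r′ zero , f-r , rf-r′ ∘ suc

injection-avoiding-two : ∀ {p ω} (k ℓ : Fin ω) → k ≢ ℓ → 2 + p ≤ ω →
  ∃ λ (e : Fin p → Fin ω) → Injective _≡_ _≡_ e × Misses e k × Misses e ℓ
injection-avoiding-two {ω = suc (suc _)} k ℓ k≢ℓ (s≤s (s≤s p≤m)) =
  e , injective , (λ t → punchInᵢ≢i k _) , misses-ℓ
  where
  ℓ′ = punchOut k≢ℓ
  e = punchIn k ∘ punchIn ℓ′ ∘ (λ t → inject≤ t p≤m)
  injective : Injective _≡_ _≡_ e
  injective = inject≤-injective p≤m p≤m _ _ ∘ punchIn-injective ℓ′ _ _ ∘ punchIn-injective k _ _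
  misses-ℓ : Misses e ℓ
  misses-ℓ t eℓ = punchInᵢ≢i ℓ′ _ (punchIn-injective k _ _ (trans eℓ (sym (punchIn-punchOut k≢ℓ))))

toℕ-punchIn≤ : ∀ {m} (i : Fin (suc m)) (k : Fin m) → toℕ (punchIn i k) ≤ suc (toℕ k)
toℕ-punchIn≤ zero    k       = ≤-refl
toℕ-punchIn≤ (suc i) zero    = z≤n
toℕ-punchIn≤ (suc i) (suc k) = s≤s (toℕ-punchIn≤ i k)

injection-avoiding-below : ∀ {p ω} (i j : Fin ω) → p < toℕ j →
  ∃ λ (e : Fin p → Fin ω) → Injective _≡_ _≡_ e × Misses e i × (∀ t → e t <ᶠ j)
injection-avoiding-below {p} {suc m} i j p<j =
  e , inject≤-injective p≤m p≤m _ _ ∘ punchIn-injective i _ _ , (λ t → punchInᵢ≢i i _) , below-j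
  where
  p≤m : p ≤ m
  p≤m = ≤-pred (≤-trans p<j (<⇒≤ (toℕ<n j)))
  e : Fin p → Fin (suc m)
  e t = punchIn i (inject≤ t p≤m)
  below-j : ∀ t → e t <ᶠ j
  below-j t = ≤-<-trans (toℕ-punchIn≤ i (inject≤ t p≤m))
    (subst (λ k → suc k < toℕ j) (sym (toℕ-inject≤ t p≤m)) (≤-trans (s≤s (toℕ<n t)) p<j))

≰∸1⇒≥ : ∀ {m q} → 1 ≤ q → ¬ (m ≤ q ∸ 1) → q ≤ m
≰∸1⇒≥ {q = suc _} _ m≰q∸1 = ≰⇒> m≰q∸1

module _ (G : Graph) where

  Vertex : Set
  Vertex = Fin (n G)

  Edge-sym : ∀ {x y} → Edge G x y → Edge G y x
  Edge-sym {x} {y} e = trans (adj-sym G y x) e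

  Edge⇒≢ : ∀ {x y} → Edge G x y → x ≢ y
  Edge⇒≢ {x} e refl with () ← trans (sym e) (adj-irrefl G x)

  Complete : ∀ {m} → (Fin m → Vertex) → Set
  Complete f = ∀ s t → s ≢ t → Edge G (f s) (f t)

  Complete⇒IsClique : ∀ {m} {f : Fin m → Vertex} → Complete f → IsClique G f
  Complete⇒IsClique {f = f} f-complete = injective , f-complete
    where
    injective : Injective _≡_ _≡_ f
    injective {s} {t} fs≡ft with s ≟ t
    ... | yes s≡t = s≡t
    ... | no s≢t = ⊥-elim (Edge⇒≢ (f-complete s t s≢t) fs≡ft)

  Complete-[] : Complete []
  Complete-[] ()

  Complete-∷ : ∀ {m z} {f : Fin m → Vertex} → Complete f → (∀ t → Edge G z (f t)) → Complete (z ∷ f)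
  Complete-∷ f-complete z-f zero    zero    0≢0 = ⊥-elim (0≢0 refl)
  Complete-∷ f-complete z-f zero    (suc t) _   = z-f t
  Complete-∷ f-complete z-f (suc s) zero    _   = Edge-sym (z-f s)
  Complete-∷ f-complete z-f (suc s) (suc t) s≢t = f-complete s t (s≢t ∘ cong suc)

  Complete-∘ : ∀ {m m′} {f : Fin m → Vertex} {e : Fin m′ → Fin m} →
    Complete f → Injective _≡_ _≡_ e → Complete (f ∘ e)
  Complete-∘ f-complete e-injective s t s≢t = f-complete _ _ (s≢t ∘ e-injective)

  updateAt-∀ : ∀ {m} (P : Vertex → Set) (f : Fin m → Vertex) k {z} →
    P z → (∀ t → t ≢ k → P (f t)) → ∀ t → P (updateAt f k (const z) t)
  updateAt-∀ P f k Pz Pf t with t ≟ k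
  ... | yes refl = subst P (sym (updateAt-updates t f)) Pz
  ... | no t≢k = subst P (sym (updateAt-minimal t k f t≢k)) (Pf t t≢k)

  Complete-updateAt : ∀ {m z} {f : Fin m → Vertex} k → Complete f → (∀ t → t ≢ k → Edge G z (f t)) →
    Complete (updateAt f k (const z))
  Complete-updateAt {z = z} {f} k f-complete z-f s t s≢t with s ≟ k | t ≟ k
  ... | yes refl | yes refl = ⊥-elim (s≢t refl)
  ... | yes refl | no t≢k
    rewrite updateAt-updates s {const z} f | updateAt-minimal t s {const z} f t≢k = z-f t t≢k
  ... | no s≢k | yes refl
    rewrite updateAt-updates t {const z} f | updateAt-minimal s t {const z} f s≢k = Edge-sym (z-f s s≢k)
  ... | no s≢k | no t≢k
    rewrite updateAt-minimal s k {const z} f s≢k | updateAt-minimal t k {const z} f t≢k = f-complete s t s≢t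

  InducedEmbedding : (H : Graph) → (Fin (n H) → Vertex) → Set
  InducedEmbedding H f = Injective _≡_ _≡_ f × (∀ a b → adj G (f a) (f b) ≡ adj H a b)

  Complete⇒K-embedding : ∀ {m} {f : Fin m → Vertex} → Complete f → InducedEmbedding (K m) f
  Complete⇒K-embedding {f = f} f-complete = proj₁ (Complete⇒IsClique f-complete) , preserves
    where
    preserves : ∀ s t → adj G (f s) (f t) ≡ Kadj s t
    preserves s t with s ≟ t
    ... | yes refl = adj-irrefl G _
    ... | no s≢t = f-complete s t s≢t

  ++-injective : ∀ {m m′} {f : Fin m → Vertex} {f′ : Fin m′ → Vertex} →
    Injective _≡_ _≡_ f → Injective _≡_ _≡_ f′ → (∀ u w → f u ≢ f′ w) →
    Injective _≡_ _≡_ (f ++ f′)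
  ++-injective {m} {m′} {f} {f′} f-inj f′-inj disjoint {x} {y} eq =
    begin
      x                       ≡⟨ join-splitAt m m′ x ⟨
      join m m′ (splitAt m x) ≡⟨ cong (join m m′) (split-eq (splitAt m x) (splitAt m y) eq) ⟩
      join m m′ (splitAt m y) ≡⟨ join-splitAt m m′ y ⟩
      y                       ∎
    where
    open ≡-Reasoning
    split-eq : ∀ a b → [ f , f′ ] a ≡ [ f , f′ ] b → a ≡ b
    split-eq (inj₁ u) (inj₁ w) eq = cong inj₁ (f-inj eq)
    split-eq (inj₁ u) (inj₂ w) eq = ⊥-elim (disjoint u w eq)
    split-eq (inj₂ u) (inj₁ w) eq = ⊥-elim (disjoint w u (sym eq))
    split-eq (inj₂ u) (inj₂ w) eq = cong inj₂ (f′-inj eq)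

  combine-embedding : ∀ b {H₁ H₂} {f₁ : Fin (n H₁) → Vertex} {f₂ : Fin (n H₂) → Vertex} →
    InducedEmbedding H₁ f₁ → InducedEmbedding H₂ f₂ →
    (∀ u w → f₁ u ≢ f₂ w) → (∀ u w → adj G (f₁ u) (f₂ w) ≡ b) →
    InducedEmbedding (combine b H₁ H₂) (f₁ ++ f₂)
  combine-embedding b {H₁} {H₂} {f₁} {f₂} (f₁-inj , f₁-adj) (f₂-inj , f₂-adj) disjoint cross =
    ++-injective f₁-inj f₂-inj disjoint , preserves
    where
    preserves : ∀ x y → adj G ((f₁ ++ f₂) x) ((f₁ ++ f₂) y) ≡ adj (combine b H₁ H₂) x y
    preserves x y with splitAt (n H₁) x | splitAt (n H₁) y
    ... | inj₁ u | inj₁ w = f₁-adj u w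
    ... | inj₁ u | inj₂ w = cross u w
    ... | inj₂ u | inj₁ w = trans (adj-sym G _ _) (cross w u)
    ... | inj₂ u | inj₂ w = f₂-adj u w

  K₁∪K₂+Kₚ-induced : ∀ {p a b₁ b₂} {h : Fin p → Vertex} →
    adj G a b₁ ≡ false → adj G a b₂ ≡ false → Edge G b₁ b₂ → Complete h →
    (∀ t → Edge G a (h t)) → (∀ t → Edge G b₁ (h t)) → (∀ t → Edge G b₂ (h t)) →
    InducedSub ((K 1 ∪ᴳ K 2) +ᴳ K p) G
  K₁∪K₂+Kₚ-induced {p} {a} {b₁} {b₂} {h} a≁b₁ a≁b₂ b₁b₂ h-complete a-h b₁-h b₂-h =
    _ , combine-embedding true
          (combine-embedding false (Complete⇒K-embedding a-complete) (Complete⇒K-embedding b-complete)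
            a∉b a≁b)
          (Complete⇒K-embedding h-complete) ab∉h ab-h
    where
    a-complete : Complete (a ∷ [])
    a-complete = Complete-∷ Complete-[] (λ ())
    b-complete : Complete (b₁ ∷ b₂ ∷ [])
    b-complete = Complete-∷ (Complete-∷ Complete-[] (λ ())) λ { zero → b₁b₂ }
    a≁b : ∀ u w → adj G ((a ∷ []) u) ((b₁ ∷ b₂ ∷ []) w) ≡ false
    a≁b zero zero = a≁b₁
    a≁b zero (suc zero) = a≁b₂
    -- b₁b₂ is an edge while ab₁ and ab₂ are not, so a ∉ {b₁, b₂}
    a∉b : ∀ u w → (a ∷ []) u ≢ (b₁ ∷ b₂ ∷ []) w
    a∉b zero zero refl with () ← trans (sym a≁b₂) b₁b₂
    a∉b zero (suc zero) refl with () ← trans (sym a≁b₁) (Edge-sym b₁b₂)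
    ab-h : ∀ u t → Edge G (((a ∷ []) ++ (b₁ ∷ b₂ ∷ [])) u) (h t)
    ab-h zero = a-h
    ab-h (suc zero) = b₁-h
    ab-h (suc (suc zero)) = b₂-h
    ab∉h : ∀ u t → ((a ∷ []) ++ (b₁ ∷ b₂ ∷ [])) u ≢ h t
    ab∉h u t = Edge⇒≢ (ab-h u t)

  Complete⇒≤ω : ∀ {ω A m} {B : Fin m → Vertex} → IsMaxClique G ω A → Complete B → m ≤ ω
  Complete⇒≤ω (_ , maximum) B-complete = maximum _ _ (Complete⇒IsClique B-complete)

module PartitionStructure {p} (G : Graph) (free : ((((K 1) ∪ᴳ (K 2)) +ᴳ (K p)) -free) G)
         {ω} {A : Fin ω → Fin (n G)} (A-maximum : IsMaxClique G ω A) (2+p≤ω : 2 + p ≤ ω) where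

  open Partition G A

  A-complete : Complete G A
  A-complete = proj₂ (proj₁ A-maximum)

  I⇒¬adj-own : ∀ {k x} → I k x → adj G x (A k) ≡ false
  I⇒¬adj-own {k} {x} (_ , x-A) with adj G x (A k) in x-Ak
  ... | false = refl
  ... | true = ⊥-elim (1+n≰n (Complete⇒≤ω G A-maximum (Complete-∷ G A-complete x-all)))
    where
    x-all : ∀ t → Edge G x (A t)
    x-all t with t ≟ k
    ... | yes refl = x-Ak
    ... | no t≢k = x-A t t≢k

  I-adjacent-I : ∀ {k ℓ x y} → k ≢ ℓ → I k x → I ℓ y → Edge G x y
  I-adjacent-I {k} {ℓ} {x} {y} k≢ℓ Ix@(_ , x-A) (_ , y-A) with adj G x y in x-y
  ... | true = refl
  ... | false with (e , e-injective , e≢k , e≢ℓ) ← injection-avoiding-two k ℓ k≢ℓ 2+p≤ω =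
    ⊥-elim (free (K₁∪K₂+Kₚ-induced G x-y (I⇒¬adj-own Ix) (y-A k k≢ℓ)
      (Complete-∘ G A-complete e-injective)
      (λ t → x-A (e t) (e≢k t)) (λ t → y-A (e t) (e≢ℓ t))
      (λ t → A-complete k (e t) (≢-sym (e≢k t)))))

  U-adjacent-U : ∀ {k ℓ x y} → k ≢ ℓ → U k x → U ℓ y → Edge G x y
  U-adjacent-U k≢ℓ (inj₁ refl) (inj₁ refl) = A-complete _ _ k≢ℓ
  U-adjacent-U k≢ℓ (inj₁ refl) (inj₂ (_ , y-A)) = Edge-sym G (y-A _ k≢ℓ)
  U-adjacent-U k≢ℓ (inj₂ (_ , x-A)) (inj₁ refl) = x-A _ (≢-sym k≢ℓ)
  U-adjacent-U k≢ℓ (inj₂ Ix) (inj₂ Iy) = I-adjacent-I k≢ℓ Ix Iy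

  U-independent : ∀ {k x y} → U k x → U k y → adj G x y ≡ false
  U-independent (inj₁ refl) (inj₁ refl) = adj-irrefl G _
  U-independent (inj₁ refl) (inj₂ Iy) = trans (adj-sym G _ _) (I⇒¬adj-own Iy)
  U-independent (inj₂ Ix) (inj₁ refl) = I⇒¬adj-own Ix
  U-independent {k} {x} {y} (inj₂ (_ , x-A)) (inj₂ (_ , y-A)) with adj G x y in x-y
  ... | false = refl
  ... | true = ⊥-elim (1+n≰n (Complete⇒≤ω G A-maximum
        (Complete-∷ G (Complete-updateAt G k A-complete x-A) y-all)))
    where
    -- replacing v_k by x in A gives another maximum clique, to which y is complete
    y-all : ∀ t → Edge G y (updateAt A k (const x) t)
    y-all = updateAt-∀ G (Edge G y) A k (Edge-sym G x-y) y-A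

  C⇒adj-below : ∀ {i j v} → C i j v → ∀ t → t ≢ i → t <ᶠ j → Edge G v (A t)
  C⇒adj-below {i} {j} {v} ((v∉A , v≁Ai , _) , earliest) t t≢i t<j with adj G v (A t) in v-At
  ... | true = refl
  ... | false with <-cmp t i
  ... | tri< t<i _ _ = ⊥-elim (earliest t i t<i (inj₁ t<i) (v∉A , v-At , v≁Ai))
  ... | tri≈ _ t≡i _ = ⊥-elim (t≢i t≡i)
  ... | tri> _ _ i<t = ⊥-elim (earliest i t i<t (inj₂ (refl , t<j)) (v∉A , v≁Ai , v-At))

  C-empty : ∀ {i j} → p < toℕ j → i <ᶠ j → ∀ v → ¬ C i j v
  C-empty {i} {j} p<j i<j v v∈C@((_ , v≁Ai , v≁Aj) , _)
    with (e , e-injective , e≢i , e<j) ← injection-avoiding-below i j p<j =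
    free (K₁∪K₂+Kₚ-induced G v≁Ai v≁Aj (A-complete i j (<⇒≢ i<j))
      (Complete-∘ G A-complete e-injective)
      (λ t → C⇒adj-below v∈C (e t) (e≢i t) (e<j t))
      (λ t → A-complete i (e t) (≢-sym (e≢i t)))
      (λ t → A-complete j (e t) (≢-sym (<⇒≢ (e<j t)))))

  module _ {x} {g : Fin p → Fin ω} (g-injective : Injective _≡_ _≡_ g)
           {y : Fin p → Fin (n G)} (y∈U : ∀ t → U (g t) (y t)) (x-y : ∀ t → Edge G x (y t)) where

    private
      y-complete : Complete G y
      y-complete s t s≢t = U-adjacent-U (s≢t ∘ g-injective) (y∈U s) (y∈U t)

    ¬adj-two-unused : ∀ {a b} → a ≢ b → Misses g a → Misses g b →
      adj G x (A a) ≡ false → adj G x (A b) ≡ false → ⊥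
    ¬adj-two-unused a≢b g-a g-b x≁Aa x≁Ab =
      free (K₁∪K₂+Kₚ-induced G x≁Aa x≁Ab (A-complete _ _ a≢b) y-complete x-y
        (λ t → U-adjacent-U (≢-sym (g-a t)) (inj₁ refl) (y∈U t))
        (λ t → U-adjacent-U (≢-sym (g-b t)) (inj₁ refl) (y∈U t)))

    -- a = v_{g c}, b₁ = x, b₂ = y_c, and the p-clique y with y_c replaced by v_r
    ¬adj-used⇒¬adj-unused : ∀ c {r} → adj G x (A (g c)) ≡ false → Misses g r → adj G x (A r) ≡ false
    ¬adj-used⇒¬adj-unused c {r} x≁Ac g-r with adj G x (A r) in x-Ar
    ... | false = refl
    ... | true = ⊥-elim (free (K₁∪K₂+Kₚ-induced G (trans (adj-sym G _ _) x≁Ac)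
          (U-independent (inj₁ refl) (y∈U c)) (x-y c)
          (Complete-updateAt G c y-complete (λ t _ → U-adjacent-U (≢-sym (g-r t)) (inj₁ refl) (y∈U t)))
          (updateAt-∀ G (Edge G (A (g c))) y c (A-complete _ _ (g-r c))
            (λ t t≢c → U-adjacent-U (t≢c ∘ sym ∘ g-injective) (inj₁ refl) (y∈U t)))
          (updateAt-∀ G (Edge G x) y c x-Ar (λ t _ → x-y t))
          (updateAt-∀ G (Edge G (y c)) y c (U-adjacent-U (g-r c) (y∈U c) (inj₁ refl))
            (λ t t≢c → y-complete c t (≢-sym t≢c)))))

    adj-used : ∀ t → Edge G x (A (g t))
    adj-used t with adj G x (A (g t)) in x≁At
    ... | true = refl
    ... | false with (r , r′ , r≢r′ , g-r , g-r′) ← two-missed-values 2+p≤ω g =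
      ⊥-elim (¬adj-two-unused r≢r′ g-r g-r′
        (¬adj-used⇒¬adj-unused t x≁At g-r) (¬adj-used⇒¬adj-unused t x≁At g-r′))

    ¬adj⇒unused : ∀ {a} → adj G x (A a) ≡ false → Misses g a
    ¬adj⇒unused x≁Aa t refl with () ← trans (sym (adj-used t)) x≁Aa

    ¬adj-two : ∀ {i j} → i ≢ j → adj G x (A i) ≡ false → adj G x (A j) ≡ false → ⊥
    ¬adj-two i≢j x≁Ai x≁Aj = ¬adj-two-unused i≢j (¬adj⇒unused x≁Ai) (¬adj⇒unused x≁Aj) x≁Ai x≁Aj

  V₂⇒few-parts : 1 ≤ p → ∀ x → V₂ x → NbrPartsAtMost x (p ∸ 1)
  V₂⇒few-parts 1≤p x (i , j , i<j , (_ , x≁Ai , x≁Aj) , _) m g g-injective nbr with m ≤? p ∸ 1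
  ... | yes m≤p∸1 = m≤p∸1
  ... | no m≰p∸1 =
    ⊥-elim (¬adj-two (inject≤-injective p≤m p≤m _ _ ∘ g-injective)
      (proj₁ ∘ proj₂ ∘ nbr′) (proj₂ ∘ proj₂ ∘ nbr′)
      (<⇒≢ i<j) x≁Ai x≁Aj)
    where
    p≤m : p ≤ m
    p≤m = ≰∸1⇒≥ 1≤p m≰p∸1
    nbr′ : ∀ t → HasNbrIn x (g (inject≤ t p≤m))
    nbr′ t = nbr (inject≤ t p≤m)

proposition3p1 : (p : ℕ) → 1 ≤ p → (G : Graph) →
    ((((K 1) ∪ᴳ (K 2)) +ᴳ (K p)) -free) G →
    (ω : ℕ) → (A : Fin ω → Fin (n G)) → IsMaxClique G ω A → p + 2 ≤ ω →
    let open Partition G A in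
      ((∀ k ℓ → k ≢ ℓ → ∀ x y → I k x → I ℓ y → Edge G x y)
        × (∀ k ℓ → k ≢ ℓ → ∀ x y → U k x → U ℓ y → Edge G x y)
        × (∀ k x y → U k x → U k y → adj G x y ≡ false))
      × (∀ i j → p + 2 ≤ toℕ j + 1 → i <ᶠ j → ∀ v → ¬ C i j v)
      × (∀ x → V₂ x → NbrPartsAtMost x (p ∸ 1))
proposition3p1 p 1≤p G free ω A A-maximum p+2≤ω =
  ( (λ _ _ k≢ℓ _ _ → I-adjacent-I k≢ℓ)
  , (λ _ _ k≢ℓ _ _ → U-adjacent-U k≢ℓ)
  , (λ _ _ _ → U-independent) )
  , (λ _ j p+2≤j+1 →
      C-empty (+-cancelʳ-≤ 1 (suc p) (toℕ j) (subst (_≤ toℕ j + 1) (+-suc p 1) p+2≤j+1)))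
  , V₂⇒few-parts 1≤p
  where open PartitionStructure G free A-maximum (subst (_≤ ω) (+-comm p 2) p+2≤ω)
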